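{- The bilinear product $\triangleright$ endows the species $\mathbb{U}$ of finite connected posets with a twisted NAP (non-associative permutative) algebra structure, i.e., the following identity holds: $$P\triangleright(Q\triangleright R)=Q\triangleright(P\triangleright R)$$ for any three finite connected posets $P, Q$ and $R$.
   Context: $\mathbb{U}$ denotes the linear species of finite connected posets: for a finite set $X$, $\mathbb{U}_X$ is the vector space freely generated by the connected partial orders on $X$. For two finite connected posets $P$ on $X_1$ and $Q$ on $X_2$ (disjoint finite sets) and $v\in X_2$, the poset $P\searrow_v Q$ on $X_1\sqcup X_2$ is obtained from the Hasse graphs $G_1$ of $P$ and $G_2$ of $Q$ by adding an oriented edge from $v$ in $G_2$ to every minimal vertex of $G_1$ (so $v$ lies below all of $P$). The bilinear product $\triangleright$ on $\mathbb{U}$ is defined by $$P\triangleright Q=\sum_{v\in \min(Q)}P\searrow_v Q,$$ where $\min(Q)$ is the set of minimal elements of $Q$. A (left) NAP algebra is a vector space with a bilinear product $\cdot$ satisfying $a\cdot(b\cdot c)=b\cdot(a\cdot c)$; "twisted" means this holds in the monoidal category of species. -}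

module Defs where

open import Data.Nat using (ℕ; _+_)
open import Data.Fin using (Fin; splitAt; _↑ˡ_; _↑ʳ_; _≟_)
open import Data.Bool using (Bool; true; false; not; _∨_; _∧_; T)
open import Data.Sum using (_⊎_; inj₁; inj₂)
open import Data.Product using (_×_)
open import Data.List using (List; map; concatMap; filterᵇ; allFin; foldr)
open import Relation.Nullary using (does)
open import Relation.Binary.PropositionalEquality using (_≡_; refl; sym; trans)
open import Relation.Binary.Bundles using (Setoid)
import Data.List.Relation.Binary.Permutation.Setoid as PermSetoid

-- A (decidable) binary relation on the finite set Fin n;
-- R x y = true means x ≤ y.
Rel : ℕ → Set
Rel n = Fin n → Fin n → Bool

record IsPoset {n : ℕ} (R : Rel n) : Set where
  field
    reflexive : ∀ x → T (R x x)
    antisym   : ∀ x y → T (R x y) → T (R y x) → x ≡ y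
    transitive : ∀ x y z → T (R x y) → T (R y z) → T (R x z)

Comparable : {n : ℕ} → Rel n → Fin n → Fin n → Set
Comparable R x y = T (R x y) ⊎ T (R y x)

data Zigzag {n : ℕ} (R : Rel n) : Fin n → Fin n → Set where
  here : ∀ {x} → Zigzag R x x
  step : ∀ {x y z} → Comparable R x y → Zigzag R y z → Zigzag R x z

IsConnected : {n : ℕ} → Rel n → Set
IsConnected {n} R = Fin n × (∀ x y → Zigzag R x y)

IsConnectedPoset : {n : ℕ} → Rel n → Set
IsConnectedPoset R = IsPoset R × IsConnected R

allᵇ : {A : Set} → (A → Bool) → List A → Bool
allᵇ f = foldr (λ a b → f a ∧ b) true

isMinimal : {n : ℕ} → Rel n → Fin n → Bool
isMinimal {n} R x = allᵇ (λ y → not (R y x) ∨ does (y ≟ x)) (allFin n)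

minimals : {n : ℕ} → Rel n → List (Fin n)
minimals R = filterᵇ (isMinimal R) (allFin _)

-- P ↘_v Q on X1 ⊔ X2 = Fin (m + n) (first block: P, second block: Q).
-- This is the order generated by P, Q and v < (minimal elements of P),
-- i.e. the reflexive-transitive closure of the Hasse graph G1 ∪ G2 ∪ {v → min P}.
graft : {m n : ℕ} → Rel m → Rel n → Fin n → Rel (m + n)
graft {m} P Q v a b with splitAt m a | splitAt m b
... | inj₁ x | inj₁ y = P x y
... | inj₂ x | inj₂ y = Q x y
... | inj₂ x | inj₁ y = Q x v
... | inj₁ x | inj₂ y = false

-- Formal linear combinations with nonnegative integer coefficients,
-- represented as lists (multisets) of basis elements.
-- P ▷ Q = Σ_{v ∈ min Q} P ↘_v Q
_▷_ : {m n : ℕ} → Rel m → Rel n → List (Rel (m + n))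
P ▷ Q = map (graft P Q) (minimals Q)

_▷L_ : {m n : ℕ} → Rel m → List (Rel n) → List (Rel (m + n))
P ▷L Qs = concatMap (P ▷_) Qs

relabel : {a b : ℕ} → (Fin a → Fin b) → Rel b → Rel a
relabel f S x y = S (f x) (f y)

twist : (p q r : ℕ) → Fin (p + (q + r)) → Fin (q + (p + r))
twist p q r a with splitAt p a
... | inj₁ x = q ↑ʳ (x ↑ˡ r)
... | inj₂ b with splitAt q b
...   | inj₁ y = y ↑ˡ (p + r)
...   | inj₂ z = q ↑ʳ (p ↑ʳ z)

RelSetoid : ℕ → Setoid _ _
RelSetoid n = record
  { Carrier = Rel n
  ; _≈_ = λ R S → ∀ x y → R x y ≡ S x y
  ; isEquivalence = record
    { refl = λ x y → refl
    ; sym = λ e x y → sym (e x y)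
    ; trans = λ e f x y → trans (e x y) (f x y) } }

-- Equality of linear combinations: equality as multisets of basis elements.
_≋_ : {n : ℕ} → List (Rel n) → List (Rel n) → Set
_≋_ {n} = PermSetoid._↭_ (RelSetoid n)

-- The two grafts in P ▷ (Q ▷ R) and Q ▷ (P ▷ R) are independent: P is placed
-- above a minimal vertex v of R and Q above a minimal vertex w of R, and the
-- result is the same poset (up to the twist of labels) whichever graft is done
-- first. The only subtlety is that the minimal vertices of Q ↘_w R are exactly
-- those of R, since w lies below all of Q and nothing of Q lies below R; so both
-- sides are the same double sum over (v, w) ∈ min R × min R, summed in the two
-- possible orders.
module Submission where

open import Defs
open import Data.Nat using (ℕ; zero; suc; _+_)
open import Data.Bool using (Bool; true; false; not; _∨_; _∧_; T)
open import Data.Bool.Properties using (∧-assoc; ∧-zeroʳ; T-≡)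
open import Data.Fin using (Fin; splitAt; _↑ˡ_; _↑ʳ_; _≟_) renaming (zero to fz; suc to fs)
open import Data.Fin.Properties using (splitAt-↑ˡ; splitAt-↑ʳ; splitAt⁻¹-↑ˡ; splitAt⁻¹-↑ʳ)
open import Data.List using (List; []; _∷_; _++_; map; concatMap; filterᵇ; allFin; tabulate)
open import Data.List.Properties using (map-∘; map-tabulate; concatMap-map; map-concatMap; concatMap-cong; filter-++; filter-none; filter-≐)
open import Data.List.Membership.Propositional using (_∈_)
open import Data.List.Membership.Propositional.Properties using (∈-allFin)
open import Data.List.Relation.Unary.All using (universal)
open import Data.List.Relation.Unary.Any using (here; there)
open import Data.Product using (_,_)
open import Data.Sum using (inj₁; inj₂)
open import Function using (_∘_; id; flip; Equivalence)
open import Relation.Binary.Bundles using (Setoid)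
open import Relation.Binary.PropositionalEquality using (_≡_; _≗_; refl; sym; trans; cong; cong₂; subst; module ≡-Reasoning)
open import Relation.Nullary using (does)
open import Relation.Nullary.Decidable using (T?)
import Data.List.Relation.Binary.Equality.Setoid as SetoidEquality
import Data.List.Relation.Binary.Permutation.Propositional as Perm
open Perm using (_↭_; ↭⇒↭ₛ′)
import Data.List.Relation.Binary.Permutation.Propositional.Properties as PermProperties
import Data.List.Relation.Binary.Permutation.Setoid as SetoidPerm

module _ {A B C : Set} (f : A → B → C) where

  map-++-concatMap-↭ : ∀ x xs (ys : List B) →
    map (f x) ys ++ concatMap (λ y → map (flip f y) xs) ys ↭ concatMap (λ y → map (flip f y) (x ∷ xs)) ys
  map-++-concatMap-↭ x xs [] = Perm.refl
  map-++-concatMap-↭ x xs (y ∷ ys) = Perm.prep (f x y)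
    (Perm.trans (PermProperties.shifts (map (f x) ys) (map (flip f y) xs))
                (PermProperties.++⁺ˡ (map (flip f y) xs) (map-++-concatMap-↭ x xs ys)))

  concatMap-map-swap : (xs : List A) (ys : List B) →
    concatMap (λ x → map (f x) ys) xs ↭ concatMap (λ y → map (flip f y) xs) ys
  concatMap-map-swap [] [] = Perm.refl
  concatMap-map-swap [] (y ∷ ys) = concatMap-map-swap [] ys
  concatMap-map-swap (x ∷ xs) ys =
    Perm.trans (PermProperties.++⁺ˡ (map (f x) ys) (concatMap-map-swap xs ys)) (map-++-concatMap-↭ x xs ys)

module _ {a ℓ} (S : Setoid a ℓ) where
  open Setoid S renaming (Carrier to X)
  open SetoidEquality S using ([]; _∷_; ++⁺) renaming (_≋_ to _≋ₛ_)

  map-cong-≋ : {A : Set} {f g : A → X} → (∀ x → f x ≈ g x) → ∀ xs → map f xs ≋ₛ map g xs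
  map-cong-≋ f≈g [] = []
  map-cong-≋ f≈g (x ∷ xs) = f≈g x ∷ map-cong-≋ f≈g xs

  concatMap-map-cong-≋ : {A B : Set} {f g : A → B → X} → (∀ x y → f x y ≈ g x y) →
    ∀ xs ys → concatMap (λ x → map (f x) ys) xs ≋ₛ concatMap (λ x → map (g x) ys) xs
  concatMap-map-cong-≋ f≈g [] ys = []
  concatMap-map-cong-≋ f≈g (x ∷ xs) ys = ++⁺ (map-cong-≋ (f≈g x) ys) (concatMap-map-cong-≋ f≈g xs ys)

module _ {A : Set} where

  allᵇ-++ : (h : A → Bool) (xs ys : List A) → allᵇ h (xs ++ ys) ≡ allᵇ h xs ∧ allᵇ h ys
  allᵇ-++ h [] ys = refl
  allᵇ-++ h (x ∷ xs) ys = trans (cong (h x ∧_) (allᵇ-++ h xs ys)) (sym (∧-assoc (h x) _ _))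

  allᵇ-map : {B : Set} (h : B → Bool) (g : A → B) (xs : List A) → allᵇ h (map g xs) ≡ allᵇ (h ∘ g) xs
  allᵇ-map h g [] = refl
  allᵇ-map h g (x ∷ xs) = cong (h (g x) ∧_) (allᵇ-map h g xs)

  allᵇ-cong : {h k : A → Bool} → h ≗ k → allᵇ h ≗ allᵇ k
  allᵇ-cong h≗k [] = refl
  allᵇ-cong h≗k (x ∷ xs) = cong₂ _∧_ (h≗k x) (allᵇ-cong h≗k xs)

  allᵇ-universal : {h : A → Bool} → (∀ x → h x ≡ true) → ∀ xs → allᵇ h xs ≡ true
  allᵇ-universal h≡true [] = refl
  allᵇ-universal h≡true (x ∷ xs) rewrite h≡true x = allᵇ-universal h≡true xs

  allᵇ-∈-false : (h : A → Bool) {x : A} {xs : List A} → x ∈ xs → h x ≡ false → allᵇ h xs ≡ false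
  allᵇ-∈-false h (here refl) hx≡false rewrite hx≡false = refl
  allᵇ-∈-false h {xs = y ∷ _} (there x∈xs) hx≡false
    rewrite allᵇ-∈-false h x∈xs hx≡false = ∧-zeroʳ (h y)

  filterᵇ-map : {B : Set} (h : B → Bool) (g : A → B) (xs : List A) →
    filterᵇ h (map g xs) ≡ map g (filterᵇ (h ∘ g) xs)
  filterᵇ-map h g [] = refl
  filterᵇ-map h g (x ∷ xs) with h (g x)
  ... | true = cong (g x ∷_) (filterᵇ-map h g xs)
  ... | false = filterᵇ-map h g xs

  filterᵇ-none : {h : A → Bool} → (∀ x → h x ≡ false) → ∀ xs → filterᵇ h xs ≡ []
  filterᵇ-none {h} h≡false xs = filter-none (T? ∘ h) (universal (λ x → subst T (h≡false x)) xs)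

  filterᵇ-cong : {h k : A → Bool} → h ≗ k → filterᵇ h ≗ filterᵇ k
  filterᵇ-cong {h} {k} h≗k = filter-≐ (T? ∘ h) (T? ∘ k) ((λ {x} → subst T (h≗k x)) , (λ {x} → subst T (sym (h≗k x))))

tabulate-+ : ∀ {A : Set} m {n} (f : Fin (m + n) → A) →
  tabulate f ≡ tabulate (f ∘ (_↑ˡ n)) ++ tabulate (f ∘ (m ↑ʳ_))
tabulate-+ zero f = refl
tabulate-+ (suc m) f = cong (f fz ∷_) (tabulate-+ m (f ∘ fs))

allFin-+ : ∀ m n → allFin (m + n) ≡ map (_↑ˡ n) (allFin m) ++ map (m ↑ʳ_) (allFin n)
allFin-+ m n = trans (tabulate-+ m id)
  (sym (cong₂ _++_ (map-tabulate id (_↑ˡ n)) (map-tabulate id (m ↑ʳ_))))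

module _ (m n : ℕ) where

  allᵇ-allFin-+ : (h : Fin (m + n) → Bool) →
    allᵇ h (allFin (m + n)) ≡ allᵇ (h ∘ (_↑ˡ n)) (allFin m) ∧ allᵇ (h ∘ (m ↑ʳ_)) (allFin n)
  allᵇ-allFin-+ h = begin
    allᵇ h (allFin (m + n))
      ≡⟨ cong (allᵇ h) (allFin-+ m n) ⟩
    allᵇ h (map (_↑ˡ n) (allFin m) ++ map (m ↑ʳ_) (allFin n))
      ≡⟨ allᵇ-++ h (map (_↑ˡ n) (allFin m)) (map (m ↑ʳ_) (allFin n)) ⟩
    allᵇ h (map (_↑ˡ n) (allFin m)) ∧ allᵇ h (map (m ↑ʳ_) (allFin n))
      ≡⟨ cong₂ _∧_ (allᵇ-map h (_↑ˡ n) (allFin m)) (allᵇ-map h (m ↑ʳ_) (allFin n)) ⟩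
    allᵇ (h ∘ (_↑ˡ n)) (allFin m) ∧ allᵇ (h ∘ (m ↑ʳ_)) (allFin n) ∎
    where open ≡-Reasoning

  filterᵇ-allFin-+ : (h : Fin (m + n) → Bool) →
    filterᵇ h (allFin (m + n)) ≡
      map (_↑ˡ n) (filterᵇ (h ∘ (_↑ˡ n)) (allFin m)) ++ map (m ↑ʳ_) (filterᵇ (h ∘ (m ↑ʳ_)) (allFin n))
  filterᵇ-allFin-+ h = begin
    filterᵇ h (allFin (m + n))
      ≡⟨ cong (filterᵇ h) (allFin-+ m n) ⟩
    filterᵇ h (map (_↑ˡ n) (allFin m) ++ map (m ↑ʳ_) (allFin n))
      ≡⟨ filter-++ (T? ∘ h) (map (_↑ˡ n) (allFin m)) (map (m ↑ʳ_) (allFin n)) ⟩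
    filterᵇ h (map (_↑ˡ n) (allFin m)) ++ filterᵇ h (map (m ↑ʳ_) (allFin n))
      ≡⟨ cong₂ _++_ (filterᵇ-map h (_↑ˡ n) (allFin m)) (filterᵇ-map h (m ↑ʳ_) (allFin n)) ⟩
    map (_↑ˡ n) (filterᵇ (h ∘ (_↑ˡ n)) (allFin m)) ++ map (m ↑ʳ_) (filterᵇ (h ∘ (m ↑ʳ_)) (allFin n)) ∎
    where open ≡-Reasoning

does-↑ʳ≟↑ʳ : ∀ m {n} (y z : Fin n) → does ((m ↑ʳ y) ≟ (m ↑ʳ z)) ≡ does (y ≟ z)
does-↑ʳ≟↑ʳ zero y z = refl
does-↑ʳ≟↑ʳ (suc m) y z = does-↑ʳ≟↑ʳ m y z

does-↑ʳ≟↑ˡ : ∀ {m n} (w : Fin n) (y : Fin m) → does ((m ↑ʳ w) ≟ (y ↑ˡ n)) ≡ false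
does-↑ʳ≟↑ˡ w fz = refl
does-↑ʳ≟↑ˡ {suc m} w (fs y) = does-↑ʳ≟↑ˡ {m} w y

module _ {m n : ℕ} (P : Rel m) (Q : Rel n) (v : Fin n) where

  graft-↑ˡ-↑ˡ : ∀ x y → graft P Q v (x ↑ˡ n) (y ↑ˡ n) ≡ P x y
  graft-↑ˡ-↑ˡ x y rewrite splitAt-↑ˡ m x n | splitAt-↑ˡ m y n = refl

  graft-↑ˡ-↑ʳ : ∀ x y → graft P Q v (x ↑ˡ n) (m ↑ʳ y) ≡ false
  graft-↑ˡ-↑ʳ x y rewrite splitAt-↑ˡ m x n | splitAt-↑ʳ m n y = refl

  graft-↑ʳ-↑ˡ : ∀ x y → graft P Q v (m ↑ʳ x) (y ↑ˡ n) ≡ Q x v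
  graft-↑ʳ-↑ˡ x y rewrite splitAt-↑ʳ m n x | splitAt-↑ˡ m y n = refl

  graft-↑ʳ-↑ʳ : ∀ x y → graft P Q v (m ↑ʳ x) (m ↑ʳ y) ≡ Q x y
  graft-↑ʳ-↑ʳ x y rewrite splitAt-↑ʳ m n x | splitAt-↑ʳ m n y = refl

module _ {m n : ℕ} (P : Rel m) (Q : Rel n) (w : Fin n) where

  isMinimal-graft-↑ˡ : T (Q w w) → ∀ y → isMinimal (graft P Q w) (y ↑ˡ n) ≡ false
  isMinimal-graft-↑ˡ Qww y = allᵇ-∈-false _ (∈-allFin (m ↑ʳ w)) w-below-y
    where
      w-below-y : not (graft P Q w (m ↑ʳ w) (y ↑ˡ n)) ∨ does ((m ↑ʳ w) ≟ (y ↑ˡ n)) ≡ false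
      w-below-y rewrite graft-↑ʳ-↑ˡ P Q w w y | Equivalence.to T-≡ Qww | does-↑ʳ≟↑ˡ w y = refl

  isMinimal-graft-↑ʳ : ∀ z → isMinimal (graft P Q w) (m ↑ʳ z) ≡ isMinimal Q z
  isMinimal-graft-↑ʳ z = begin
    isMinimal (graft P Q w) (m ↑ʳ z)
      ≡⟨ allᵇ-allFin-+ m n below-z ⟩
    allᵇ (below-z ∘ (_↑ˡ n)) (allFin m) ∧ allᵇ (below-z ∘ (m ↑ʳ_)) (allFin n)
      ≡⟨ cong₂ _∧_ (allᵇ-universal P-not-below-z (allFin m)) (allᵇ-cong Q-below-z (allFin n)) ⟩
    isMinimal Q z ∎
    where
      open ≡-Reasoning
      below-z : Fin (m + n) → Bool
      below-z x = not (graft P Q w x (m ↑ʳ z)) ∨ does (x ≟ (m ↑ʳ z))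
      P-not-below-z : ∀ x → below-z (x ↑ˡ n) ≡ true
      P-not-below-z x rewrite graft-↑ˡ-↑ʳ P Q w x z = refl
      Q-below-z : ∀ y → below-z (m ↑ʳ y) ≡ not (Q y z) ∨ does (y ≟ z)
      Q-below-z y rewrite graft-↑ʳ-↑ʳ P Q w y z | does-↑ʳ≟↑ʳ m y z = refl

  minimals-graft : T (Q w w) → minimals (graft P Q w) ≡ map (m ↑ʳ_) (minimals Q)
  minimals-graft Qww = begin
    minimals (graft P Q w)
      ≡⟨ filterᵇ-allFin-+ m n (isMinimal (graft P Q w)) ⟩
    map (_↑ˡ n) (filterᵇ (isMinimal (graft P Q w) ∘ (_↑ˡ n)) (allFin m))
      ++ map (m ↑ʳ_) (filterᵇ (isMinimal (graft P Q w) ∘ (m ↑ʳ_)) (allFin n))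
      ≡⟨ cong₂ (λ xs ys → map (_↑ˡ n) xs ++ map (m ↑ʳ_) ys)
               (filterᵇ-none (isMinimal-graft-↑ˡ Qww) (allFin m))
               (filterᵇ-cong isMinimal-graft-↑ʳ (allFin n)) ⟩
    map (m ↑ʳ_) (minimals Q) ∎
    where open ≡-Reasoning

module _ (p q r : ℕ) where

  twist-↑ˡ : ∀ x → twist p q r (x ↑ˡ (q + r)) ≡ q ↑ʳ (x ↑ˡ r)
  twist-↑ˡ x rewrite splitAt-↑ˡ p x (q + r) = refl

  twist-↑ʳ-↑ˡ : ∀ y → twist p q r (p ↑ʳ (y ↑ˡ r)) ≡ y ↑ˡ (p + r)
  twist-↑ʳ-↑ˡ y rewrite splitAt-↑ʳ p (q + r) (y ↑ˡ r) | splitAt-↑ˡ q y r = refl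

  twist-↑ʳ-↑ʳ : ∀ z → twist p q r (p ↑ʳ (q ↑ʳ z)) ≡ q ↑ʳ (p ↑ʳ z)
  twist-↑ʳ-↑ʳ z rewrite splitAt-↑ʳ p (q + r) (q ↑ʳ z) | splitAt-↑ʳ q r z = refl

data Summand (m n : ℕ) : Fin (m + n) → Set where
  left : (x : Fin m) → Summand m n (x ↑ˡ n)
  right : (y : Fin n) → Summand m n (m ↑ʳ y)

summand : ∀ m n (a : Fin (m + n)) → Summand m n a
summand m n a with splitAt m a in eq
... | inj₁ x with refl ← splitAt⁻¹-↑ˡ eq = left x
... | inj₂ y with refl ← splitAt⁻¹-↑ʳ eq = right y

data Block (p q r : ℕ) : Fin (p + (q + r)) → Set where
  inP : (x : Fin p) → Block p q r (x ↑ˡ (q + r))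
  inQ : (y : Fin q) → Block p q r (p ↑ʳ (y ↑ˡ r))
  inR : (z : Fin r) → Block p q r (p ↑ʳ (q ↑ʳ z))

block : ∀ p q r (a : Fin (p + (q + r))) → Block p q r a
block p q r a with summand p (q + r) a
... | left x = inP x
... | right b with summand q r b
...   | left y = inQ y
...   | right z = inR z

module _ {p q r : ℕ} (P : Rel p) (Q : Rel q) (R : Rel r) (v w : Fin r) where

  graft-graft-twist : ∀ a b →
    graft P (graft Q R w) (q ↑ʳ v) a b ≡ relabel (twist p q r) (graft Q (graft P R v) (p ↑ʳ w)) a b
  graft-graft-twist a b with block p q r a | block p q r b
  ... | inP x | inP y
    rewrite twist-↑ˡ p q r x | twist-↑ˡ p q r y
          | graft-↑ˡ-↑ˡ P (graft Q R w) (q ↑ʳ v) x y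
          | graft-↑ʳ-↑ʳ Q (graft P R v) (p ↑ʳ w) (x ↑ˡ r) (y ↑ˡ r) | graft-↑ˡ-↑ˡ P R v x y = refl
  ... | inP x | inQ y
    rewrite twist-↑ˡ p q r x | twist-↑ʳ-↑ˡ p q r y
          | graft-↑ˡ-↑ʳ P (graft Q R w) (q ↑ʳ v) x (y ↑ˡ r)
          | graft-↑ʳ-↑ˡ Q (graft P R v) (p ↑ʳ w) (x ↑ˡ r) y | graft-↑ˡ-↑ʳ P R v x w = refl
  ... | inP x | inR z
    rewrite twist-↑ˡ p q r x | twist-↑ʳ-↑ʳ p q r z
          | graft-↑ˡ-↑ʳ P (graft Q R w) (q ↑ʳ v) x (q ↑ʳ z)
          | graft-↑ʳ-↑ʳ Q (graft P R v) (p ↑ʳ w) (x ↑ˡ r) (p ↑ʳ z) | graft-↑ˡ-↑ʳ P R v x z = refl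
  ... | inQ x | inP y
    rewrite twist-↑ʳ-↑ˡ p q r x | twist-↑ˡ p q r y
          | graft-↑ʳ-↑ˡ P (graft Q R w) (q ↑ʳ v) (x ↑ˡ r) y | graft-↑ˡ-↑ʳ Q R w x v
          | graft-↑ˡ-↑ʳ Q (graft P R v) (p ↑ʳ w) x (y ↑ˡ r) = refl
  ... | inQ x | inQ y
    rewrite twist-↑ʳ-↑ˡ p q r x | twist-↑ʳ-↑ˡ p q r y
          | graft-↑ʳ-↑ʳ P (graft Q R w) (q ↑ʳ v) (x ↑ˡ r) (y ↑ˡ r) | graft-↑ˡ-↑ˡ Q R w x y
          | graft-↑ˡ-↑ˡ Q (graft P R v) (p ↑ʳ w) x y = refl
  ... | inQ x | inR z
    rewrite twist-↑ʳ-↑ˡ p q r x | twist-↑ʳ-↑ʳ p q r z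
          | graft-↑ʳ-↑ʳ P (graft Q R w) (q ↑ʳ v) (x ↑ˡ r) (q ↑ʳ z) | graft-↑ˡ-↑ʳ Q R w x z
          | graft-↑ˡ-↑ʳ Q (graft P R v) (p ↑ʳ w) x (p ↑ʳ z) = refl
  ... | inR z | inP y
    rewrite twist-↑ʳ-↑ʳ p q r z | twist-↑ˡ p q r y
          | graft-↑ʳ-↑ˡ P (graft Q R w) (q ↑ʳ v) (q ↑ʳ z) y | graft-↑ʳ-↑ʳ Q R w z v
          | graft-↑ʳ-↑ʳ Q (graft P R v) (p ↑ʳ w) (p ↑ʳ z) (y ↑ˡ r) | graft-↑ʳ-↑ˡ P R v z y = refl
  ... | inR z | inQ y
    rewrite twist-↑ʳ-↑ʳ p q r z | twist-↑ʳ-↑ˡ p q r y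
          | graft-↑ʳ-↑ʳ P (graft Q R w) (q ↑ʳ v) (q ↑ʳ z) (y ↑ˡ r) | graft-↑ʳ-↑ˡ Q R w z y
          | graft-↑ʳ-↑ˡ Q (graft P R v) (p ↑ʳ w) (p ↑ʳ z) y | graft-↑ʳ-↑ʳ P R v z w = refl
  ... | inR z | inR z′
    rewrite twist-↑ʳ-↑ʳ p q r z | twist-↑ʳ-↑ʳ p q r z′
          | graft-↑ʳ-↑ʳ P (graft Q R w) (q ↑ʳ v) (q ↑ʳ z) (q ↑ʳ z′) | graft-↑ʳ-↑ʳ Q R w z z′
          | graft-↑ʳ-↑ʳ Q (graft P R v) (p ↑ʳ w) (p ↑ʳ z) (p ↑ʳ z′) | graft-↑ʳ-↑ʳ P R v z z′ = refl

module _ {p q r : ℕ} (P : Rel p) (Q : Rel q) (R : Rel r) where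

  ▷-graft : ∀ w → T (R w w) → P ▷ graft Q R w ≡ map (λ v → graft P (graft Q R w) (q ↑ʳ v)) (minimals R)
  ▷-graft w Rww = trans (cong (map (graft P (graft Q R w))) (minimals-graft Q R w Rww)) (sym (map-∘ (minimals R)))

  ▷L-▷ : (∀ w → T (R w w)) →
    P ▷L (Q ▷ R) ≡ concatMap (λ w → map (λ v → graft P (graft Q R w) (q ↑ʳ v)) (minimals R)) (minimals R)
  ▷L-▷ R-refl = trans (concatMap-map (P ▷_) (graft Q R) (minimals R))
                      (concatMap-cong (λ w → ▷-graft w (R-refl w)) (minimals R))

proposition3p5 : (p q r : ℕ) (P : Rel p) (Q : Rel q) (R : Rel r) → IsConnectedPoset P → IsConnectedPoset Q → IsConnectedPoset R
    → (P ▷L (Q ▷ R)) ≋ map (relabel (twist p q r)) (Q ▷L (P ▷ R))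
proposition3p5 p q r P Q R _ _ (R-poset , _) = begin
  P ▷L (Q ▷ R)                                        ≡⟨ ▷L-▷ P Q R R-refl ⟩
  concatMap (λ w → map (λ v → P↘Q↘R v w) M) M         ↭⟨ ↭⇒↭ₛ′ ≈-isEquivalence (concatMap-map-swap (flip P↘Q↘R) M M) ⟩
  concatMap (λ v → map (P↘Q↘R v) M) M                 ≋⟨ concatMap-map-cong-≋ (RelSetoid _) (graft-graft-twist P Q R) M M ⟩
  concatMap (λ v → map (relabel tw ∘ Q↘P↘R v) M) M    ≡⟨ concatMap-cong (λ v → map-∘ M) M ⟩
  concatMap (map (relabel tw) ∘ λ v → map (Q↘P↘R v) M) M
                                                      ≡⟨ map-concatMap (relabel tw) (λ v → map (Q↘P↘R v) M) M ⟨
  map (relabel tw) (concatMap (λ v → map (Q↘P↘R v) M) M)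
                                                      ≡⟨ cong (map (relabel tw)) (▷L-▷ Q P R R-refl) ⟨
  map (relabel tw) (Q ▷L (P ▷ R))                     ∎
  where
    open SetoidPerm.PermutationReasoning (RelSetoid (p + (q + r)))
    open Setoid (RelSetoid (p + (q + r))) using () renaming (isEquivalence to ≈-isEquivalence)
    M : List (Fin r)
    M = minimals R
    tw : Fin (p + (q + r)) → Fin (q + (p + r))
    tw = twist p q r
    R-refl : ∀ z → T (R z z)
    R-refl = IsPoset.reflexive R-poset
    P↘Q↘R : Fin r → Fin r → Rel (p + (q + r))
    P↘Q↘R v w = graft P (graft Q R w) (q ↑ʳ v)
    Q↘P↘R : Fin r → Fin r → Rel (q + (p + r))
    Q↘P↘R v w = graft Q (graft P R v) (p ↑ʳ w)
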